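{- For every graph $G$ and every vertex $v\in V(G)$, there is a linear clique-width expression of $G$ using at most $\operatorname{lcw}(G)+1$ labels whose first operation is the insertion of the vertex $v$.
   Context: A linear clique-width (lcw) expression for a graph $G$ is a sequence of the operations: (1) introduce a new vertex with some label; (2) for labels $i\neq j$, add edges between all vertices labeled $i$ and all vertices labeled $j$; (3) for labels $i\ne j$, relabel all vertices labeled $i$ to $j$; whose result is $G$. The linear clique-width $\operatorname{lcw}(G)$ is the minimum number of labels used by an lcw expression for $G$. -}

module Defs where

open import Data.Nat using (ℕ; _≤_)
open import Data.Fin using (Fin; _≟_)
open import Data.Bool using (Bool; true; false; _∧_; _∨_)
open import Data.Maybe using (Maybe; just; nothing)
open import Data.List using (List; []; _∷_)
open import Data.Product using (Σ; _×_; _,_; ∃)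
open import Relation.Nullary using (¬_; does)
open import Relation.Binary.PropositionalEquality using (_≡_; _≢_)

record Graph (n : ℕ) : Set where
  field
    adj   : Fin n → Fin n → Bool
    sym   : ∀ x y → adj x y ≡ adj y x
    loopless : ∀ x → adj x x ≡ false

-- Operations of a linear clique-width expression building a graph on
-- the (named) vertex set Fin n, using the label set Fin k.
data Op (n k : ℕ) : Set where
  intro   : (v : Fin n) (i : Fin k) → Op n k
  join    : (i j : Fin k) → i ≢ j → Op n k
  relabel : (i j : Fin k) → i ≢ j → Op n k

Expr : ℕ → ℕ → Set
Expr n k = List (Op n k)

-- Intermediate state: the label of each vertex introduced so far
-- (nothing = not yet introduced), and the current adjacency.
record State (n k : ℕ) : Set where
  constructor st
  field
    label : Fin n → Maybe (Fin k)
    edge  : Fin n → Fin n → Bool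

open State

private
  hasLabel : ∀ {k} → Maybe (Fin k) → Fin k → Bool
  hasLabel nothing  i = false
  hasLabel (just a) i = does (a ≟ i)

initial : ∀ {n k} → State n k
initial = st (λ _ → nothing) (λ _ _ → false)

-- One step; fails (nothing) if a vertex is introduced twice.
step : ∀ {n k} → Op n k → State n k → Maybe (State n k)
step (intro v i) s with label s v
... | just _  = nothing
... | nothing = just (st (λ x → if' (does (x ≟ v)) (just i) (label s x)) (edge s))
  where
    if' : ∀ {A : Set} → Bool → A → A → A
    if' true a b = a
    if' false a b = b
step (join i j _) s = just (st (label s) (λ x y →
  edge s x y ∨ (hasLabel (label s x) i ∧ hasLabel (label s y) j)
             ∨ (hasLabel (label s x) j ∧ hasLabel (label s y) i)))
step (relabel i j _) s = just (st (λ x → relab (label s x)) (edge s))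
  where
    relab : Maybe _ → Maybe _
    relab nothing  = nothing
    relab (just a) with a ≟ i
    ... | Relation.Nullary.yes _ = just j
    ... | Relation.Nullary.no  _ = just a

run : ∀ {n k} → Expr n k → State n k → Maybe (State n k)
run []       s = just s
run (o ∷ os) s with step o s
... | nothing = nothing
... | just s' = run os s'

Represents : ∀ {n k} → State n k → Graph n → Set
Represents {n} {k} s G =
  (∀ x → ∃ λ (i : Fin k) → label s x ≡ just i) ×
  (∀ x y → edge s x y ≡ Graph.adj G x y)

IsExprFor : ∀ {n k} → Expr n k → Graph n → Set
IsExprFor e G = ∃ λ s → run e initial ≡ just s × Represents s G

HasLcwExpr : ∀ {n} → Graph n → ℕ → Set
HasLcwExpr {n} G k = ∃ λ (e : Expr n k) → IsExprFor e G

Lcw : ∀ {n} → Graph n → ℕ → Set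
Lcw G k = HasLcwExpr G k × (∀ m → HasLcwExpr G m → k ≤ m)

{-# OPTIONS --safe #-}
module Submission where

-- Insert v first, under a label 0 reserved for it, and run the given
-- expression with every label i shifted to suc i. Where the given expression
-- inserts v with label i, relabel 0 to suc i instead. Until then no join of the
-- shifted expression involves label 0, so v has no edges, exactly as if it had
-- not been inserted yet.

open import Defs
open import Data.Nat using (ℕ; suc)
open import Data.Fin using (Fin; zero; suc; _≟_)
open import Data.Fin.Properties using (0≢1+n; suc-injective)
open import Data.List using ([]; _∷_; map)
open import Data.Maybe using (Maybe; just; nothing)
open import Data.Product using (∃; _×_; _,_)
open import Data.Empty using (⊥-elim)
open import Function using (_∘_)
open import Relation.Nullary using (yes; no)
open import Relation.Binary.PropositionalEquality using (_≡_; _≢_; refl; trans)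

open State

module _ {n k : ℕ} (v : Fin n) where

  liftOp : Op n k → Op n (suc k)
  liftOp (intro u i) with u ≟ v
  ... | yes _ = relabel zero (suc i) 0≢1+n
  ... | no  _ = intro u (suc i)
  liftOp (join i j i≢j)    = join (suc i) (suc j) (i≢j ∘ suc-injective)
  liftOp (relabel i j i≢j) = relabel (suc i) (suc j) (i≢j ∘ suc-injective)

  data LabelSim (x : Fin n) : Maybe (Fin k) → Maybe (Fin (suc k)) → Set where
    placed  : ∀ a → LabelSim x (just a) (just (suc a))
    waiting : x ≡ v → LabelSim x nothing (just zero)
    absent  : x ≢ v → LabelSim x nothing nothing

  record Simulates (s : State n k) (s' : State n (suc k)) : Set where
    field
      edges  : ∀ x y → edge s' x y ≡ edge s x y
      labels : ∀ x → LabelSim x (label s x) (label s' x)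
  open Simulates

  initial-sim : ∀ {t'} → step (intro v zero) initial ≡ just t' → Simulates initial t'
  initial-sim {t'} refl = record { edges = λ _ _ → refl ; labels = labels′ }
    where
    labels′ : ∀ x → LabelSim x nothing (label t' x)
    labels′ x with x ≟ v
    ... | yes x≡v = waiting x≡v
    ... | no  x≢v = absent x≢v

  lift-step-defined : ∀ o {s s' t} → Simulates s s' → step o s ≡ just t →
    ∃ λ t' → step (liftOp o) s' ≡ just t'
  lift-step-defined (intro u i) {s} {s'} sim eq with u ≟ v
  ... | yes _ = _ , refl
  ... | no u≢v with label s u | label s' u | labels sim u | eq
  ...   | nothing | _ | waiting u≡v | _ = ⊥-elim (u≢v u≡v)
  ...   | nothing | _ | absent _    | _ = _ , refl
  lift-step-defined (join _ _ _)    _ _ = _ , refl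
  lift-step-defined (relabel _ _ _) _ _ = _ , refl

  -- The successor states are built by helpers private to Defs and cannot be
  -- written down here, so they are introduced through the step equations.
  StepSim : Op n k → Op n (suc k) → Set
  StepSim o o' = ∀ {s s' t t'} → Simulates s s' →
    step o s ≡ just t → step o' s' ≡ just t' → Simulates t t'

  intro-v-sim : ∀ i → StepSim (intro v i) (relabel zero (suc i) 0≢1+n)
  intro-v-sim i {s} {s'} {t} {t'} sim eq refl with label s v in v-new | eq
  ... | nothing | refl = record { edges = edges sim ; labels = labels′ v-new }
    where
    labels′ : label s v ≡ nothing → ∀ x → LabelSim x (label t x) (label t' x)
    labels′ v-new x with x ≟ v
    labels′ v-new x | no x≢v with label s x | label s' x | labels sim x
    ... | _ | _ | placed a    = placed a
    ... | _ | _ | waiting x≡v = ⊥-elim (x≢v x≡v)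
    ... | _ | _ | absent _    = absent x≢v
    labels′ v-new x | yes refl with label s x | label s' x | labels sim x | v-new
    ... | _ | _ | placed _   | ()
    ... | _ | _ | waiting _  | refl = placed i
    ... | _ | _ | absent x≢x | _    = ⊥-elim (x≢x refl)

  intro-other-sim : ∀ u i → StepSim (intro u i) (intro u (suc i))
  intro-other-sim u i {s} {s'} {t} {t'} sim eq eq' with label s u | eq | label s' u | eq'
  ... | nothing | refl | nothing | refl = record { edges = edges sim ; labels = labels′ }
    where
    labels′ : ∀ x → LabelSim x (label t x) (label t' x)
    labels′ x with x ≟ u
    ... | yes _ = placed i
    ... | no  _ = labels sim x

  join-sim : ∀ i j i≢j → StepSim (join i j i≢j) (liftOp (join i j i≢j))
  join-sim i j _ {s} {s'} {t} {t'} sim refl refl = record { edges = edges′ ; labels = labels sim }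
    where
    -- Shifting labels by suc keeps every case computable: suc a ≟ suc b reduces
    -- to a ≟ b, and zero ≟ suc b to no.
    edges′ : ∀ x y → edge t' x y ≡ edge t x y
    edges′ x y rewrite edges sim x y
      with label s x | label s' x | labels sim x | label s y | label s' y | labels sim y
    ... | _ | _ | placed _  | _ | _ | placed _  = refl
    ... | _ | _ | placed _  | _ | _ | waiting _ = refl
    ... | _ | _ | placed _  | _ | _ | absent _  = refl
    ... | _ | _ | waiting _ | _ | _ | placed _  = refl
    ... | _ | _ | waiting _ | _ | _ | waiting _ = refl
    ... | _ | _ | waiting _ | _ | _ | absent _  = refl
    ... | _ | _ | absent _  | _ | _ | placed _  = refl
    ... | _ | _ | absent _  | _ | _ | waiting _ = refl
    ... | _ | _ | absent _  | _ | _ | absent _  = refl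

  relabel-sim : ∀ i j i≢j → StepSim (relabel i j i≢j) (liftOp (relabel i j i≢j))
  relabel-sim i j _ {s} {s'} {t} {t'} sim refl refl = record { edges = edges sim ; labels = labels′ }
    where
    labels′ : ∀ x → LabelSim x (label t x) (label t' x)
    labels′ x with label s x | label s' x | labels sim x
    ... | _ | _ | waiting x≡v = waiting x≡v
    ... | _ | _ | absent  x≢v = absent x≢v
    ... | _ | _ | placed a with a ≟ i
    ...   | yes _ = placed j
    ...   | no  _ = placed a

  step-sim : ∀ o → StepSim o (liftOp o)
  step-sim (intro u i) with u ≟ v
  ... | yes refl = intro-v-sim i
  ... | no  _    = intro-other-sim u i
  step-sim (join i j i≢j)    = join-sim i j i≢j
  step-sim (relabel i j i≢j) = relabel-sim i j i≢j

  run-sim : ∀ os {s s' t} → Simulates s s' → run os s ≡ just t →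
    ∃ λ t' → run (map liftOp os) s' ≡ just t' × Simulates t t'
  run-sim []       sim refl = _ , refl , sim
  run-sim (o ∷ os) {s} {s'} sim eq with step o s in step-o
  ... | just u with lift-step-defined o sim step-o
  ...   | _ , step-o' rewrite step-o' = run-sim os (step-sim o sim step-o step-o') eq

  insert-first : ∀ {G : Graph n} (e : Expr n k) → IsExprFor e G →
    IsExprFor (intro v zero ∷ map liftOp e) G
  insert-first e (t , run-e , labelled , edges-G)
    with run-sim e (initial-sim refl) run-e
  ... | t' , run-e' , sim = t' , run-e' , labelled′ , λ x y → trans (edges sim x y) (edges-G x y)
    where
    labelled′ : ∀ x → ∃ λ i → label t' x ≡ just i
    labelled′ x with label t x | label t' x | labels sim x | labelled x
    ... | _ | _ | placed a | _ = suc a , refl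

proposition3p4 : ∀ {n} (G : Graph n) (k : ℕ) (v : Fin n) → Lcw G k →
    ∃ λ (e : Expr n (suc k)) → IsExprFor e G ×
      ∃ λ (i : Fin (suc k)) → ∃ λ (rest : Expr n (suc k)) → e ≡ intro v i ∷ rest
proposition3p4 G k v ((e , e-for-G) , _) =
  intro v zero ∷ map (liftOp v) e , insert-first v {G} e e-for-G , zero , _ , refl
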